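{- Let $H$ be a graph with no isolated vertex. Then for every family $\mathcal{P}=\{\mathcal{P}(v): v\in V_H\}$ with $\mathcal{P}(v)$ a partition of $N_{S_2(H)}(v)$, and for every function $\theta$ from the set of leaves of $S_2(H,\mathcal{P})$ to the positive integers, the graph $S_2(H,\mathcal{P},\theta)$ is a DTDP-graph; moreover $(V^o,V^n)$ is a DT-pair of $S_2(H,\mathcal{P},\theta)$.
   Context: Graphs may have multiple edges and multiple loops. For a vertex $v$, $N_G(v)$ is the set of vertices adjacent to $v$ (a vertex with a loop is its own neighbour); degree counts loops twice; a leaf is a vertex of degree 1. A set $D$ is dominating if every vertex not in $D$ has a neighbour in $D$; $T$ is total dominating if every vertex (including those in $T$) has a neighbour in $T$. A DT-pair is a pair $(D,T)$ of disjoint vertex sets with $D$ dominating and $T$ total dominating; a graph is a DTDP-graph if it has a DT-pair. 2-subdivision graphs: $S_2(H)$ is obtained from $H$ by inserting two new vertices into each edge and loop: for an edge $e$ with ends $u\ne v$ add vertices $u_e,v_e$ and edges $uu_e,u_ev_e,v_ev$; for a loop $e$ at $v$ add $v_e^1,v_e^2$ and edges $vv_e^1,v_e^1v_e^2,v_e^2v$. For $v\in V_H$, $N_{S_2(H)}(v)$ is the set of new vertices adjacent to $v$. Given partitions $\mathcal{P}(v)$ of $N_{S_2(H)}(v)$, $S_2(H,\mathcal{P})$ has vertex set $V_H\cup\{(v,A): v\in V_H, A\in\mathcal{P}(v)\}$; each $v$ is joined by one edge to each $(v,A)$; each edge $e$ of $H$ with ends $u\neq v$ gives one edge joining $(u,B)$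 and $(v,A)$ where $u_e\in B$, $v_e\in A$; each loop $e$ at $v$ gives one edge joining $(v,A)$ and $(v,A')$ where $v_e^1\in A$, $v_e^2\in A'$ (a loop if $A=A'$). (Equivalently, identify the vertices of each class $A$ into one vertex $(v,A)$.) For $\theta$ a positive-integer function on the leaves of $S_2(H,\mathcal{P})$, $S_2(H,\mathcal{P},\theta)$ is obtained by replacing each leaf $x$ by $\theta(x)$ leaves $(x,1),\dots,(x,\theta(x))$ adjacent to the neighbour of $x$. In it, $V^n$ is the set of vertices $(v,A)$ and $V^o$ is the set of all other vertices. -}

module Defs where

open import Data.Nat using (ℕ; zero; suc; _+_; _≤_; _≡ᵇ_)
open import Data.Bool using (Bool; true; false; if_then_else_)
open import Data.Fin using (Fin)
import Data.Fin.Properties as FinP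
open import Data.List using (List; []; _∷_; map; concatMap; allFin; _++_)
open import Data.Nat.ListAction using (sum)
open import Data.Unit using (⊤)
open import Data.List.Membership.Propositional using (_∈_)
open import Data.Product using (Σ; ∃; _×_; _,_; proj₁; proj₂)
open import Data.Sum using (_⊎_; inj₁; inj₂)
import Data.Sum.Properties as SumP
import Data.Product.Properties as ProdP
open import Data.Empty using (⊥)
open import Relation.Nullary using (does)
open import Relation.Binary.Definitions using (DecidableEquality)
open import Relation.Binary.PropositionalEquality using (_≡_)

-- General (multi)graphs: a vertex type and a list of edges.
-- Each list entry (a , b) is one edge with ends a and b; repeated entries
-- are parallel edges, an entry (a , a) is a loop.

record Graph : Set₁ where
  field
    V     : Set
    edges : List (V × V)
open Graph public

Adj : (G : Graph) → V G → V G → Set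
Adj G x y = ((x , y) ∈ edges G) ⊎ ((y , x) ∈ edges G)

-- degree: number of edge ends at x (loops count twice)
degree : (G : Graph) → DecidableEquality (V G) → V G → ℕ
degree G _≟_ x = sum (map (λ p → ind (proj₁ p) + ind (proj₂ p)) (edges G))
  where
  ind : V G → ℕ
  ind a = if does (a ≟ x) then 1 else 0

IsLeaf : (G : Graph) → DecidableEquality (V G) → V G → Set
IsLeaf G dec x = degree G dec x ≡ 1

isLeafᵇ : (G : Graph) → DecidableEquality (V G) → V G → Bool
isLeafᵇ G dec x = degree G dec x ≡ᵇ 1

Dominating : (G : Graph) → (V G → Set) → Set
Dominating G D = ∀ x → D x ⊎ (∃ λ y → Adj G x y × D y)

TotalDominating : (G : Graph) → (V G → Set) → Set
TotalDominating G T = ∀ x → ∃ λ y → Adj G x y × T y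

Disjoint : (G : Graph) → (V G → Set) → (V G → Set) → Set
Disjoint G D T = ∀ x → D x → T x → ⊥

IsDTPair : (G : Graph) → (V G → Set) → (V G → Set) → Set
IsDTPair G D T = Disjoint G D T × Dominating G D × TotalDominating G T

IsDTDP : Graph → Set₁
IsDTDP G = Σ (V G → Set) λ D → Σ (V G → Set) λ T → IsDTPair G D T

-- The base graph H: vertices Fin n, edges Fin m, ends : Fin m → Fin n × Fin n
-- (loops are edges with equal ends, parallel edges allowed).

NoIsolated : (n m : ℕ) → (Fin m → Fin n × Fin n) → Set
NoIsolated n m ends = ∀ v → ∃ λ e → (proj₁ (ends e) ≡ v) ⊎ (proj₂ (ends e) ≡ v)

-- The new vertices of S₂(H): for the edge e with ends (u , v) the dart
-- (e , false) is u_e (adjacent to u) and (e , true) is v_e (adjacent to v);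
-- for a loop at v these are v_e^1 and v_e^2.
Dart : ℕ → Set
Dart m = Fin m × Bool

att : {n m : ℕ} → (Fin m → Fin n × Fin n) → Dart m → Fin n
att ends (e , false) = proj₁ (ends e)
att ends (e , true)  = proj₂ (ends e)

-- A family of partitions P(v) of N_{S₂(H)}(v) = {d : att d ≡ v}:
-- P(v) has k v classes, indexed by Fin (k v); the dart d lies in class
-- cls d of P(att d).  Every class must be nonempty.
IsPartitionFamily : {n m : ℕ} (ends : Fin m → Fin n × Fin n)
  (k : Fin n → ℕ) → ((d : Dart m) → Fin (k (att ends d))) → Set
IsPartitionFamily {n} {m} ends k cls =
  ∀ (v : Fin n) (i : Fin (k v)) →
    ∃ λ (d : Dart m) → _≡_ {A = Σ (Fin n) (λ w → Fin (k w))} (att ends d , cls d) (v , i)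

-- vertices of S₂(H,P): inj₁ v for v ∈ V_H, inj₂ (v , i) for the class (v , A_i)
VS2 : (n : ℕ) → (Fin n → ℕ) → Set
VS2 n k = Fin n ⊎ Σ (Fin n) (λ v → Fin (k v))

decVS2 : (n : ℕ) (k : Fin n → ℕ) → DecidableEquality (VS2 n k)
decVS2 n k = SumP.≡-dec FinP._≟_ (ProdP.≡-dec FinP._≟_ FinP._≟_)

S2 : {n m : ℕ} (ends : Fin m → Fin n × Fin n) (k : Fin n → ℕ)
  (cls : (d : Dart m) → Fin (k (att ends d))) → Graph
S2 {n} {m} ends k cls = record
  { V = VS2 n k
  ; edges = spokes ++ hedges
  }
  where
  cl : Dart m → VS2 n k
  cl d = inj₂ (att ends d , cls d)
  spokes : List (VS2 n k × VS2 n k)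
  spokes = concatMap (λ v → map (λ i → (inj₁ v , inj₂ (v , i))) (allFin (k v))) (allFin n)
  hedges : List (VS2 n k × VS2 n k)
  hedges = map (λ e → (cl (e , false) , cl (e , true))) (allFin m)

copies : {n m : ℕ} (ends : Fin m → Fin n × Fin n) (k : Fin n → ℕ)
  (cls : (d : Dart m) → Fin (k (att ends d))) → (VS2 n k → ℕ) → VS2 n k → ℕ
copies {n} ends k cls θ x =
  if isLeafᵇ (S2 ends k cls) (decVS2 n k) x then θ x else 1

-- Each edge ab of S₂(H,P) yields an edge
-- between every copy of a and every copy of b (in S₂(H,P) no two leaves are
-- adjacent, so this is exactly: the θ(x) new leaves are adjacent to the
-- neighbour of x).
S2θ : {n m : ℕ} (ends : Fin m → Fin n × Fin n) (k : Fin n → ℕ)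
  (cls : (d : Dart m) → Fin (k (att ends d))) → (VS2 n k → ℕ) → Graph
S2θ {n} ends k cls θ = record
  { V = Σ (VS2 n k) (λ x → Fin (c x))
  ; edges = concatMap
      (λ p → concatMap
        (λ i → map (λ j → ((proj₁ p , i) , (proj₂ p , j))) (allFin (c (proj₂ p))))
        (allFin (c (proj₁ p))))
      (edges (S2 ends k cls))
  }
  where
  c : VS2 n k → ℕ
  c = copies ends k cls θ

Vo : {n : ℕ} {k : Fin n → ℕ} {c : VS2 n k → ℕ} → Σ (VS2 n k) (λ x → Fin (c x)) → Set
Vo (inj₁ _ , _) = ⊤
Vo (inj₂ _ , _) = ⊥

Vn : {n : ℕ} {k : Fin n → ℕ} {c : VS2 n k → ℕ} → Σ (VS2 n k) (λ x → Fin (c x)) → Set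
Vn (inj₁ _ , _) = ⊥
Vn (inj₂ _ , _) = ⊤

-- Every vertex v of H is an end of some edge e, so v is adjacent to the class
-- vertex containing its dart of e; a class vertex contains some dart d and is
-- therefore adjacent to the class vertex at the other end of d's edge.  So the
-- class vertices V^n totally dominate S₂(H,P), and they are dominated by the
-- vertices of H, each class vertex (v,A) being adjacent to v.  Multiplying
-- leaves is a blow-up in which every vertex keeps at least one copy, and such
-- blow-ups carry DT-pairs to DT-pairs.
module Submission where

open import Defs
open import Data.Nat using (ℕ; _≤_; z≤n; s≤s)
open import Data.Fin using (Fin; fromℕ<)
open import Data.Product using (_×_; _,_; proj₁; proj₂; Σ; ∃)
open import Data.Sum using (inj₁; inj₂; swap)
open import Data.Bool using (true; false; not; T)
open import Data.Unit using (⊤; tt)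
open import Data.Empty using (⊥)
open import Data.List using (List; concatMap; map; allFin)
open import Data.List.Membership.Propositional using (_∈_; lose)
open import Data.List.Membership.Propositional.Properties
  using (∈-concatMap⁺; ∈-map⁺; ∈-++⁺ˡ; ∈-++⁺ʳ; ∈-allFin)
open import Data.Nat.Properties using (≡ᵇ⇒≡)
open import Relation.Binary.PropositionalEquality using (_≡_; refl; sym; subst; _≗_)
open import Function using (id; _∘_)

∈-concatMap-intro : ∀ {A B : Set} (f : A → List B) {x xs y} →
                    x ∈ xs → y ∈ f x → y ∈ concatMap f xs
∈-concatMap-intro f x∈xs y∈fx = ∈-concatMap⁺ f (lose x∈xs y∈fx)

IsDTPair-resp : (G : Graph) {D D′ T T′ : V G → Set} → D ≗ D′ → T ≗ T′ →
                IsDTPair G D T → IsDTPair G D′ T′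
IsDTPair-resp G {D} {D′} {T} {T′} D≗D′ T≗T′ (disjoint , dominating , total) =
  disjoint′ , dominating′ , total′
  where
  disjoint′ : Disjoint G D′ T′
  disjoint′ x d′ t′ = disjoint x (subst id (sym (D≗D′ x)) d′) (subst id (sym (T≗T′ x)) t′)

  dominating′ : Dominating G D′
  dominating′ x with dominating x
  ... | inj₁ dx = inj₁ (subst id (D≗D′ x) dx)
  ... | inj₂ (y , x~y , dy) = inj₂ (y , x~y , subst id (D≗D′ y) dy)

  total′ : TotalDominating G T′
  total′ x with total x
  ... | y , x~y , ty = y , x~y , subst id (T≗T′ y) ty

-- S₂(H,P,θ) is by definition blowUp (S₂(H,P)) (copies θ).
blowUp : (G : Graph) → (V G → ℕ) → Graph
blowUp G c = record
  { V = Σ (V G) (λ x → Fin (c x))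
  ; edges = concatMap
      (λ p → concatMap
        (λ i → map (λ j → ((proj₁ p , i) , (proj₂ p , j))) (allFin (c (proj₂ p))))
        (allFin (c (proj₁ p))))
      (edges G)
  }

module _ (G : Graph) (c : V G → ℕ) where

  blowUp-edge : ∀ {a b} → (a , b) ∈ edges G → (i : Fin (c a)) (j : Fin (c b)) →
                ((a , i) , (b , j)) ∈ edges (blowUp G c)
  blowUp-edge ab∈G i j =
    ∈-concatMap-intro _ ab∈G (∈-concatMap-intro _ (∈-allFin i) (∈-map⁺ _ (∈-allFin j)))

  blowUp-Adj : ∀ {a b} → Adj G a b → (i : Fin (c a)) (j : Fin (c b)) →
               Adj (blowUp G c) (a , i) (b , j)
  blowUp-Adj (inj₁ ab∈G) i j = inj₁ (blowUp-edge ab∈G i j)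
  blowUp-Adj (inj₂ ba∈G) i j = inj₂ (blowUp-edge ba∈G j i)

  blowUp-IsDTPair : (∀ x → Fin (c x)) → {D T : V G → Set} → IsDTPair G D T →
                    IsDTPair (blowUp G c) (D ∘ proj₁) (T ∘ proj₁)
  blowUp-IsDTPair copy (disjoint , dominating , total) =
    disjoint′ , dominating′ , total′
    where
    disjoint′ : Disjoint (blowUp G c) _ _
    disjoint′ (x , _) = disjoint x

    dominating′ : Dominating (blowUp G c) _
    dominating′ (x , i) with dominating x
    ... | inj₁ dx = inj₁ dx
    ... | inj₂ (y , x~y , dy) = inj₂ ((y , copy y) , blowUp-Adj x~y i (copy y) , dy)

    total′ : TotalDominating (blowUp G c) _
    total′ (x , i) with total x
    ... | y , x~y , ty = (y , copy y) , blowUp-Adj x~y i (copy y) , ty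

module _ {n : ℕ} {k : Fin n → ℕ} where

  IsBaseVertex : VS2 n k → Set
  IsBaseVertex (inj₁ _) = ⊤
  IsBaseVertex (inj₂ _) = ⊥

  IsClassVertex : VS2 n k → Set
  IsClassVertex (inj₁ _) = ⊥
  IsClassVertex (inj₂ _) = ⊤

  Vo≗IsBaseVertex : {c : VS2 n k → ℕ} → Vo {c = c} ≗ IsBaseVertex ∘ proj₁
  Vo≗IsBaseVertex (inj₁ _ , _) = refl
  Vo≗IsBaseVertex (inj₂ _ , _) = refl

  Vn≗IsClassVertex : {c : VS2 n k → ℕ} → Vn {c = c} ≗ IsClassVertex ∘ proj₁
  Vn≗IsClassVertex (inj₁ _ , _) = refl
  Vn≗IsClassVertex (inj₂ _ , _) = refl

module _ {n m : ℕ} (ends : Fin m → Fin n × Fin n) (k : Fin n → ℕ)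
         (cls : (d : Dart m) → Fin (k (att ends d))) where

  classOf : Dart m → VS2 n k
  classOf d = inj₂ (att ends d , cls d)

  opposite : Dart m → Dart m
  opposite (e , b) = e , not b

  base-Adj-class : ∀ v i → Adj (S2 ends k cls) (inj₁ v) (inj₂ (v , i))
  base-Adj-class v i =
    inj₁ (∈-++⁺ˡ (∈-concatMap-intro _ (∈-allFin v) (∈-map⁺ _ (∈-allFin i))))

  edge-∈-S2 : ∀ e → (classOf (e , false) , classOf (e , true)) ∈ edges (S2 ends k cls)
  edge-∈-S2 e = ∈-++⁺ʳ _ (∈-map⁺ _ (∈-allFin e))

  classOf-Adj-opposite : ∀ d → Adj (S2 ends k cls) (classOf d) (classOf (opposite d))
  classOf-Adj-opposite (e , false) = inj₁ (edge-∈-S2 e)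
  classOf-Adj-opposite (e , true)  = inj₂ (edge-∈-S2 e)

  S2-IsDTPair : NoIsolated n m ends → IsPartitionFamily ends k cls →
                IsDTPair (S2 ends k cls) IsBaseVertex IsClassVertex
  S2-IsDTPair noIsolated partition = disjoint , dominating , total
    where
    disjoint : Disjoint (S2 ends k cls) IsBaseVertex IsClassVertex
    disjoint (inj₁ _) _ ()
    disjoint (inj₂ _) ()

    dominating : Dominating (S2 ends k cls) IsBaseVertex
    dominating (inj₁ _) = inj₁ tt
    dominating (inj₂ (v , i)) = inj₂ (inj₁ v , swap (base-Adj-class v i) , tt)

    base-Adj-classOf : ∀ v d → att ends d ≡ v →
                       ∃ λ y → Adj (S2 ends k cls) (inj₁ v) y × IsClassVertex y
    base-Adj-classOf _ d refl = classOf d , base-Adj-class _ (cls d) , tt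

    total : TotalDominating (S2 ends k cls) IsClassVertex
    total (inj₁ v) with noIsolated v
    ... | e , inj₁ end₁≡v = base-Adj-classOf v (e , false) end₁≡v
    ... | e , inj₂ end₂≡v = base-Adj-classOf v (e , true) end₂≡v
    total (inj₂ (v , i)) with partition v i
    ... | d , refl = classOf (opposite d) , classOf-Adj-opposite d , tt

  copies-positive : (θ : VS2 n k → ℕ) →
                    (∀ x → IsLeaf (S2 ends k cls) (decVS2 n k) x → 1 ≤ θ x) →
                    ∀ x → 1 ≤ copies ends k cls θ x
  copies-positive θ θ-positive x with isLeafᵇ (S2 ends k cls) (decVS2 n k) x in isLeaf
  ... | true  = θ-positive x (≡ᵇ⇒≡ _ _ (subst T (sym isLeaf) tt))
  ... | false = s≤s z≤n

proposition3p2 : (n m : ℕ) (ends : Fin m → Fin n × Fin n) → NoIsolated n m ends →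
    (k : Fin n → ℕ) (cls : (d : Dart m) → Fin (k (att ends d))) → IsPartitionFamily ends k cls →
    (θ : VS2 n k → ℕ) → (∀ x → IsLeaf (S2 ends k cls) (decVS2 n k) x → 1 ≤ θ x) →
    IsDTDP (S2θ ends k cls θ) × IsDTPair (S2θ ends k cls θ) Vo Vn
proposition3p2 n m ends noIsolated k cls partition θ θ-positive = (Vo , Vn , pair) , pair
  where
  copy : ∀ x → Fin (copies ends k cls θ x)
  copy x = fromℕ< (copies-positive ends k cls θ θ-positive x)

  pair : IsDTPair (S2θ ends k cls θ) Vo Vn
  pair = IsDTPair-resp (S2θ ends k cls θ)
           (sym ∘ Vo≗IsBaseVertex) (sym ∘ Vn≗IsClassVertex)
           (blowUp-IsDTPair (S2 ends k cls) (copies ends k cls θ) copy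
             (S2-IsDTPair ends k cls noIsolated partition))
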